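{- (1) There is a Boolean contact algebra that does not satisfy (C5), has no atoms, and has a G-representative that is not a W-representative. (2) There is a Boolean contact algebra that does not satisfy (C5), has atoms, and in which every G-representative is a W-representative.
   Context: A Boolean contact algebra is a Boolean algebra $\langle B,\cdot,+,-,\mathsf{0},\mathsf{1}\rangle$ with a relation $\mathsf{C}$ satisfying (C0) $\neg(\mathsf{0}\mathrel{\mathsf{C}} x)$; (C1) $x\leq y\wedge x\neq\mathsf{0}\to x\mathrel{\mathsf{C}} y$; (C2) symmetry; (C3) $x\leq y\to\forall z(z\mathrel{\mathsf{C}} x\to z\mathrel{\mathsf{C}} y)$; (C4) $x\mathrel{\mathsf{C}}(y+z)\to x\mathrel{\mathsf{C}} y\vee x\mathrel{\mathsf{C}} z$. $x\ll y$ iff $\neg(x\mathrel{\mathsf{C}} -y)$; $x\mathrel{\mathsf{O}} y$ iff $x\cdot y\neq\mathsf{0}$. (C5) is the axiom $\forall x\neq\mathsf{0}\,\exists y\neq\mathsf{0}\; y\ll x$. For $X,Y\subseteq B$, $X\trianglelefteq Y$ means: for every $y\in Y$ there is $x\in X$ with $x\leq y$. A G-representative is a non-empty $Q\subseteq B$ with (r0) $\mathsf{0}\notin Q$; (r1) for all $u,v\in Q$: $u=v$ or $u\ll v$ or $v\ll u$; (r2) for every $u\in Q$ there is $v\in Q$ with $v\ll u$; (r3) for all $x,y$: if $u\mathrel{\mathsf{O}} x$ and $u\mathrel{\mathsf{O}} y$ for all $u\in Q$ then $x\mathrel{\mathsf{C}} y$. An abstractive set is $A\subseteq B$ with (r0),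 (r1) and (A): there is no non-zero $x\in B$ with $x\leq y$ for all $y\in A$. A W-representative is an abstractive set $A$ such that for every abstractive set $D$, $D\trianglelefteq A$ implies $A\trianglelefteq D$. -}

module Defs where

open import Level using (0ℓ)
open import Data.Product using (Σ; ∃; _×_; _,_)
open import Data.Sum using (_⊎_)
open import Relation.Nullary using (¬_)
open import Relation.Unary using (Pred)
open import Relation.Binary.PropositionalEquality using (_≡_)
import Algebra.Lattice.Structures as LS

record BCA : Set₁ where
  infixl 7 _·_
  infixl 6 _+_
  field
    B    : Set
    _·_  : B → B → B
    _+_  : B → B → B
    -_   : B → B
    𝟘    : B
    𝟙    : B
    isBooleanAlgebra : LS.IsBooleanAlgebra (_≡_ {A = B}) _+_ _·_ -_ 𝟙 𝟘
    _C_  : B → B → Set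

  _≤_ : B → B → Set
  x ≤ y = x · y ≡ x

  field
    C0 : ∀ x → ¬ (𝟘 C x)
    C1 : ∀ x y → x ≤ y → ¬ (x ≡ 𝟘) → x C y
    C2 : ∀ x y → x C y → y C x
    C3 : ∀ x y → x ≤ y → ∀ z → z C x → z C y
    C4 : ∀ x y z → x C (y + z) → (x C y) ⊎ (x C z)

  _≪_ : B → B → Set
  x ≪ y = ¬ (x C (- y))

  _O_ : B → B → Set
  x O y = ¬ (x · y ≡ 𝟘)

  C5 : Set
  C5 = ∀ x → ¬ (x ≡ 𝟘) → ∃ λ y → ¬ (y ≡ 𝟘) × (y ≪ x)

  IsAtom : B → Set
  IsAtom a = ¬ (a ≡ 𝟘) × (∀ x → x ≤ a → (x ≡ 𝟘) ⊎ (x ≡ a))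

  HasAtoms : Set
  HasAtoms = ∃ IsAtom

  _⊴_ : Pred B 0ℓ → Pred B 0ℓ → Set
  X ⊴ Y = ∀ y → Y y → ∃ λ x → X x × (x ≤ y)

  r0 : Pred B 0ℓ → Set
  r0 Q = ¬ Q 𝟘

  r1 : Pred B 0ℓ → Set
  r1 Q = ∀ u v → Q u → Q v → (u ≡ v) ⊎ (u ≪ v) ⊎ (v ≪ u)

  r2 : Pred B 0ℓ → Set
  r2 Q = ∀ u → Q u → ∃ λ v → Q v × (v ≪ u)

  r3 : Pred B 0ℓ → Set
  r3 Q = ∀ x y → (∀ u → Q u → (u O x) × (u O y)) → x C y

  IsGRep : Pred B 0ℓ → Set
  IsGRep Q = (∃ λ u → Q u) × r0 Q × r1 Q × r2 Q × r3 Q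

  condA : Pred B 0ℓ → Set
  condA A = ¬ (∃ λ x → ¬ (x ≡ 𝟘) × (∀ y → A y → x ≤ y))

  IsAbstractive : Pred B 0ℓ → Set
  IsAbstractive A = r0 A × r1 A × condA A

  IsWRep : Pred B 0ℓ → Set₁
  IsWRep A = IsAbstractive A × (∀ (D : Pred B 0ℓ) → IsAbstractive D → D ⊴ A → A ⊴ D)

-- (1) On the clopen subsets of Cantor space (the countable atomless Boolean
-- algebra) take the largest contact: any two non-zero elements touch.  Since
-- 𝟙 ≪ 𝟙 and 𝟙 overlaps every non-zero element, {𝟙} is a G-representative, but
-- 𝟙 is a non-zero lower bound of {𝟙}, so {𝟙} is not even abstractive.  (C5)
-- fails at any x with x, -x ≠ 𝟘, since every non-zero y touches -x.
--
-- (2) On the subsets of the path p – q – r, with contact "containing equal or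
-- adjacent points", the non-zero pairs y ≪ x are: any y with x = 𝟙, y = {p}
-- with x = {p,q}, and y = {r} with x = {q,r}.  Hence a chain t ≪ w ≪ v ≪ u with
-- t ≠ 𝟘 forces u = 𝟙, so by (r0) and (r2) every member of a G-representative
-- is 𝟙, and (r3) would then put {p} in contact with {r}: there are no
-- G-representatives at all.  The atom {p} has no non-zero y ≪ {p}, so (C5) fails.
module Submission where

open import Defs
open import Level using (0ℓ)
open import Algebra.Core using (Op₁; Op₂)
open import Algebra.Lattice using (IsDistributiveLattice; IsBooleanAlgebra; BooleanAlgebra)
import Algebra.Lattice.Properties.BooleanAlgebra as BooleanAlgebraProperties
open import Algebra.Lattice.Morphism.Structures using (IsLatticeMonomorphism)
import Algebra.Lattice.Morphism.LatticeMonomorphism as LatticeMonomorphism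
open import Algebra.Lattice.Structures.Biased using (isBooleanAlgebraʳ)
open import Data.Bool using (Bool; true; false; not; _∧_; _∨_; _xor_; if_then_else_)
import Data.Bool.Properties as Bool
open import Data.Empty using (⊥; ⊥-elim)
import Data.Empty.Irrelevant as Irrelevant
open import Data.Fin using (Fin; zero; suc; toℕ)
open import Data.Fin.Properties using (any?)
import Data.Fin.Subset as S
open import Data.Fin.Subset using (Subset; _∈_; ⁅_⁆; Nonempty)
open import Data.Fin.Subset.Properties
  using (_∈?_; ∉⊥; x∈p∩q⁻; x∈p∪q⁻; nonempty?; Empty-unique; anySubset?; ∪-∩-isBooleanAlgebra)
open import Data.List using (List; []; _∷_; foldr; length)
open import Data.Nat using (ℕ; zero; suc; _≤?_; ∣_-_∣; z≤n) renaming (_≤_ to _≤ℕ_)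
open import Data.Nat.Properties using (∣n-n∣≡0; ∣-∣-comm)
open import Data.Product using (Σ; ∃; ∃₂; _×_; _,_; proj₁; proj₂; swap)
open import Data.Sum using (_⊎_; inj₁; inj₂; [_,_])
open import Data.Unit using (tt) renaming (⊤ to Unit)
open import Data.Vec.Properties using (≡-dec)
open import Function using (_∘_; case_of_)
open import Relation.Binary using (Rel; Reflexive; Symmetric; Decidable)
open import Relation.Binary.PropositionalEquality
  using (_≡_; _≗_; refl; sym; trans; cong; cong₂; cong-app; subst; subst₂; module ≡-Reasoning)
open import Relation.Nullary using (¬_; Dec; yes; no; ¬?; _×-dec_; _→-dec_; _⊎-dec_)
import Relation.Nullary.Decidable as Dec
open import Relation.Nullary.Decidable using (from-yes; from-no; decidable-stable)
open import Relation.Unary using (Pred)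

module _ (𝔅 : BCA) where
  open BCA 𝔅
  private
    booleanAlgebra : BooleanAlgebra 0ℓ 0ℓ
    booleanAlgebra = record { isBooleanAlgebra = isBooleanAlgebra }

    module BA where
      open BooleanAlgebra booleanAlgebra public
      open BooleanAlgebraProperties booleanAlgebra public

  ⁅𝟙⁆ : Pred B 0ℓ
  ⁅𝟙⁆ u = u ≡ 𝟙

  ·-≤ˡ : ∀ x y → (x · y) ≤ x
  ·-≤ˡ x y = begin
    (x · y) · x  ≡⟨ BA.∧-comm (x · y) x ⟩
    x · (x · y)  ≡⟨ BA.∧-assoc x x y ⟨
    (x · x) · y  ≡⟨ cong (_· y) (BA.∧-idem x) ⟩
    x · y        ∎
    where open ≡-Reasoning

  overlaps⇒≢𝟘 : ∀ {u x} → u O x → ¬ x ≡ 𝟘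
  overlaps⇒≢𝟘 {u} u·x≢𝟘 refl = u·x≢𝟘 (BA.∧-zeroʳ u)

  𝟙-overlaps : ∀ {x} → ¬ x ≡ 𝟘 → 𝟙 O x
  𝟙-overlaps {x} x≢𝟘 𝟙·x≡𝟘 = x≢𝟘 (trans (sym (BA.∧-identityˡ x)) 𝟙·x≡𝟘)

  𝟙≪𝟙 : 𝟙 ≪ 𝟙
  𝟙≪𝟙 𝟙C-𝟙 = C0 𝟙 (C2 𝟙 𝟘 (subst (𝟙 C_) BA.¬⊤≈⊥ 𝟙C-𝟙))

  ⁅𝟙⁆-isGRep : ¬ 𝟙 ≡ 𝟘 → (∀ x y → ¬ x ≡ 𝟘 → ¬ y ≡ 𝟘 → x C y) → IsGRep ⁅𝟙⁆
  ⁅𝟙⁆-isGRep 𝟙≢𝟘 connected =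
      (𝟙 , refl)
    , (λ 𝟘≡𝟙 → 𝟙≢𝟘 (sym 𝟘≡𝟙))
    , (λ { _ _ refl refl → inj₁ refl })
    , (λ { _ refl → 𝟙 , refl , 𝟙≪𝟙 })
    , λ x y overlaps → let (𝟙Ox , 𝟙Oy) = overlaps 𝟙 refl in
        connected x y (overlaps⇒≢𝟘 𝟙Ox) (overlaps⇒≢𝟘 𝟙Oy)

  ⁅𝟙⁆-¬isWRep : ¬ 𝟙 ≡ 𝟘 → ¬ IsWRep ⁅𝟙⁆
  ⁅𝟙⁆-¬isWRep 𝟙≢𝟘 ((_ , _ , noLowerBound) , _) =
    noLowerBound (𝟙 , 𝟙≢𝟘 , λ { _ refl → BA.∧-idem 𝟙 })

  r2⇒descent : ∀ {Q u} → r2 Q → Q u →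
               ∃₂ λ v w → ∃ λ t → Q t × t ≪ w × w ≪ v × v ≪ u
  r2⇒descent r2Q Qu with r2Q _ Qu
  ... | v , Qv , v≪u with r2Q v Qv
  ... | w , Qw , w≪v with r2Q w Qw
  ... | t , Qt , t≪w = v , w , t , Qt , t≪w , w≪v , v≪u

  ⊆⁅𝟙⁆∧r3⇒connected : ∀ {Q} → r3 Q → (∀ u → Q u → u ≡ 𝟙) →
                       ∀ {x y} → ¬ x ≡ 𝟘 → ¬ y ≡ 𝟘 → x C y
  ⊆⁅𝟙⁆∧r3⇒connected r3Q Q⊆⁅𝟙⁆ x≢𝟘 y≢𝟘 = r3Q _ _ λ u Qu →
    subst (λ v → v O _ × v O _) (sym (Q⊆⁅𝟙⁆ u Qu)) (𝟙-overlaps x≢𝟘 , 𝟙-overlaps y≢𝟘)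

  splitting⇒¬HasAtoms : (∀ a → ¬ a ≡ 𝟘 → ∃ λ c → ¬ a · c ≡ 𝟘 × ¬ a · c ≡ a) → ¬ HasAtoms
  splitting⇒¬HasAtoms split (a , a≢𝟘 , atomic) with split a a≢𝟘
  ... | c , a·c≢𝟘 , a·c≢a = [ a·c≢𝟘 , a·c≢a ] (atomic (a · c) (·-≤ˡ a c))

module FullContact {B : Set} {_+_ _·_ : Op₂ B} { -_ : Op₁ B} {𝟙 𝟘 : B}
  (isBooleanAlgebra : IsBooleanAlgebra _≡_ _+_ _·_ -_ 𝟙 𝟘) (_≟𝟘 : ∀ x → Dec (x ≡ 𝟘)) where

  private
    booleanAlgebra : BooleanAlgebra 0ℓ 0ℓ
    booleanAlgebra = record { isBooleanAlgebra = isBooleanAlgebra }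

    module BA where
      open BooleanAlgebra booleanAlgebra public
      open BooleanAlgebraProperties booleanAlgebra public

  _bothNonzero_ : B → B → Set
  x bothNonzero y = ¬ x ≡ 𝟘 × ¬ y ≡ 𝟘

  below-≢𝟘 : ∀ {x y} → x · y ≡ x → ¬ x ≡ 𝟘 → ¬ y ≡ 𝟘
  below-≢𝟘 {x} x·y≡x x≢𝟘 refl = x≢𝟘 (trans (sym x·y≡x) (BA.∧-zeroʳ x))

  join-≢𝟘 : ∀ {y z} → ¬ y + z ≡ 𝟘 → (¬ y ≡ 𝟘) ⊎ (¬ z ≡ 𝟘)
  join-≢𝟘 {y} {z} y+z≢𝟘 with y ≟𝟘 | z ≟𝟘
  ... | no y≢𝟘 | _ = inj₁ y≢𝟘
  ... | yes _ | no z≢𝟘 = inj₂ z≢𝟘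
  ... | yes refl | yes refl = ⊥-elim (y+z≢𝟘 (BA.∨-idem 𝟘))

  fullContactAlgebra : BCA
  fullContactAlgebra = record
    { B = B ; _·_ = _·_ ; _+_ = _+_ ; -_ = -_ ; 𝟘 = 𝟘 ; 𝟙 = 𝟙
    ; isBooleanAlgebra = isBooleanAlgebra
    ; _C_ = _bothNonzero_
    ; C0 = λ _ (𝟘≢𝟘 , _) → 𝟘≢𝟘 refl
    ; C1 = λ _ _ x≤y x≢𝟘 → x≢𝟘 , below-≢𝟘 x≤y x≢𝟘
    ; C2 = λ _ _ → swap
    ; C3 = λ _ _ x≤y _ (z≢𝟘 , x≢𝟘) → z≢𝟘 , below-≢𝟘 x≤y x≢𝟘
    ; C4 = λ _ _ _ (x≢𝟘 , y+z≢𝟘) → [ inj₁ ∘ (x≢𝟘 ,_) , inj₂ ∘ (x≢𝟘 ,_) ] (join-≢𝟘 y+z≢𝟘)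
    }

  fullContact-connected : ∀ x y → ¬ x ≡ 𝟘 → ¬ y ≡ 𝟘 → x bothNonzero y
  fullContact-connected _ _ = _,_

  fullContact-¬C5 : ∀ x → ¬ x ≡ 𝟘 → ¬ - x ≡ 𝟘 → ¬ BCA.C5 fullContactAlgebra
  fullContact-¬C5 x x≢𝟘 -x≢𝟘 c5 with c5 x x≢𝟘
  ... | y , y≢𝟘 , y≪x = y≪x (y≢𝟘 , -x≢𝟘)

-- Clopen subsets of Cantor space

pointwise-isDistributiveLattice : ∀ {A C : Set} {_⊔_ _⊓_ : Op₂ C} →
  IsDistributiveLattice _≡_ _⊔_ _⊓_ →
  IsDistributiveLattice (_≗_ {A = A}) (λ f g a → f a ⊔ g a) (λ f g a → f a ⊓ g a)
pointwise-isDistributiveLattice L = record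
  { isLattice = record
    { isEquivalence = record { refl = λ _ → refl ; sym = λ f≗g a → sym (f≗g a)
                             ; trans = λ f≗g g≗h a → trans (f≗g a) (g≗h a) }
    ; ∨-comm  = λ f g a → L.∨-comm (f a) (g a)
    ; ∨-assoc = λ f g h a → L.∨-assoc (f a) (g a) (h a)
    ; ∨-cong  = λ f≗g h≗k a → L.∨-cong (f≗g a) (h≗k a)
    ; ∧-comm  = λ f g a → L.∧-comm (f a) (g a)
    ; ∧-assoc = λ f g h a → L.∧-assoc (f a) (g a) (h a)
    ; ∧-cong  = λ f≗g h≗k a → L.∧-cong (f≗g a) (h≗k a)
    ; absorptive = (λ f g a → L.∨-absorbs-∧ (f a) (g a)) , (λ f g a → L.∧-absorbs-∨ (f a) (g a))
    }
  ; ∨-distrib-∧ = (λ f g h a → L.∨-distribˡ-∧ (f a) (g a) (h a))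
                , (λ f g h a → L.∨-distribʳ-∧ (f a) (g a) (h a))
  ; ∧-distrib-∨ = (λ f g h a → L.∧-distribˡ-∨ (f a) (g a) (h a))
                , (λ f g h a → L.∧-distribʳ-∨ (f a) (g a) (h a))
  }
  where module L = IsDistributiveLattice L

Path : Set
Path = ℕ → Bool

_◂_ : Bool → Path → Path
(b ◂ p) zero = b
(b ◂ p) (suc n) = p n

prefix : List Bool → Path → Path
prefix bs p = foldr _◂_ p bs

data Tree : Set where
  leaf : Bool → Tree
  node : Tree → Tree → Tree

⟦_⟧ : Tree → Path → Bool
⟦ leaf b ⟧ p = b
⟦ node l r ⟧ p = if p zero then ⟦ r ⟧ (λ n → p (suc n)) else ⟦ l ⟧ (λ n → p (suc n))

SameLeaf : Tree → Tree → Set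
SameLeaf (leaf a) (leaf b) = a ≡ b
SameLeaf _ _ = ⊥

sameLeaf? : ∀ l r → Dec (SameLeaf l r)
sameLeaf? (leaf a) (leaf b) = a Bool.≟ b
sameLeaf? (leaf _) (node _ _) = no λ ()
sameLeaf? (node _ _) _ = no λ ()

Normal : Tree → Set
Normal (leaf _) = Unit
Normal (node l r) = Normal l × Normal r × ¬ SameLeaf l r

branch : Tree → Tree → Tree
branch l r with sameLeaf? l r
... | yes _ = l
... | no _ = node l r

branch-normal : ∀ {l r} → Normal l → Normal r → Normal (branch l r)
branch-normal {l} {r} nl nr with sameLeaf? l r
... | yes _ = nl
... | no ¬same = nl , nr , ¬same

⟦branch⟧ : ∀ l r → ⟦ branch l r ⟧ ≗ ⟦ node l r ⟧
⟦branch⟧ l r p with sameLeaf? l r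
⟦branch⟧ (leaf a) (leaf .a) p | yes refl with p zero
... | true = refl
... | false = refl
⟦branch⟧ l r p | no _ = refl

zipWith : (Bool → Bool → Bool) → Tree → Tree → Tree
zipWith f (leaf a) (leaf b) = leaf (f a b)
zipWith f (leaf a) (node l r) = branch (zipWith f (leaf a) l) (zipWith f (leaf a) r)
zipWith f (node l r) (leaf b) = branch (zipWith f l (leaf b)) (zipWith f r (leaf b))
zipWith f (node l r) (node l′ r′) = branch (zipWith f l l′) (zipWith f r r′)

zipWith-normal : ∀ f s t → Normal (zipWith f s t)
zipWith-normal f (leaf a) (leaf b) = tt
zipWith-normal f (leaf a) (node l r) = branch-normal (zipWith-normal f (leaf a) l) (zipWith-normal f (leaf a) r)
zipWith-normal f (node l r) (leaf b) = branch-normal (zipWith-normal f l (leaf b)) (zipWith-normal f r (leaf b))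
zipWith-normal f (node l r) (node l′ r′) = branch-normal (zipWith-normal f l l′) (zipWith-normal f r r′)

⟦zipWith⟧ : ∀ f s t p → ⟦ zipWith f s t ⟧ p ≡ f (⟦ s ⟧ p) (⟦ t ⟧ p)
⟦zipWith⟧ f (leaf a) (leaf b) p = refl
⟦zipWith⟧ f (leaf a) (node l r) p
  rewrite ⟦branch⟧ (zipWith f (leaf a) l) (zipWith f (leaf a) r) p with p zero
... | true = ⟦zipWith⟧ f (leaf a) r _
... | false = ⟦zipWith⟧ f (leaf a) l _
⟦zipWith⟧ f (node l r) (leaf b) p
  rewrite ⟦branch⟧ (zipWith f l (leaf b)) (zipWith f r (leaf b)) p with p zero
... | true = ⟦zipWith⟧ f r (leaf b) _
... | false = ⟦zipWith⟧ f l (leaf b) _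
⟦zipWith⟧ f (node l r) (node l′ r′) p
  rewrite ⟦branch⟧ (zipWith f l l′) (zipWith f r r′) p with p zero
... | true = ⟦zipWith⟧ f r r′ _
... | false = ⟦zipWith⟧ f l l′ _

mutual
  ⟦⟧-injective : ∀ {s t} → .(Normal s) → .(Normal t) → ⟦ s ⟧ ≗ ⟦ t ⟧ → s ≡ t
  ⟦⟧-injective {leaf a} {leaf b} _ _ eq = cong leaf (eq (λ _ → false))
  ⟦⟧-injective {leaf a} {node l r} _ nt eq = Irrelevant.⊥-elim (node-nonconstant nt (λ p → sym (eq p)))
  ⟦⟧-injective {node l r} {leaf b} ns _ eq = Irrelevant.⊥-elim (node-nonconstant ns eq)
  ⟦⟧-injective {node l r} {node l′ r′} ns nt eq =
    cong₂ node (⟦⟧-injective (proj₁ ns) (proj₁ nt) (λ p → eq (false ◂ p)))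
               (⟦⟧-injective (proj₁ (proj₂ ns)) (proj₁ (proj₂ nt)) (λ p → eq (true ◂ p)))

  node-nonconstant : ∀ {l r a} → Normal (node l r) → ¬ (⟦ node l r ⟧ ≗ ⟦ leaf a ⟧)
  node-nonconstant {l} {r} {a} (nl , nr , ¬same) eq = ¬same (subst₂ SameLeaf (sym l≡a) (sym r≡a) refl)
    where
    l≡a : l ≡ leaf a
    l≡a = ⟦⟧-injective nl tt (λ p → eq (false ◂ p))
    r≡a : r ≡ leaf a
    r≡a = ⟦⟧-injective nr tt (λ p → eq (true ◂ p))

-- Normality makes ⟦_⟧ injective, so _≡_ on Clopen is equality of clopen sets;
-- the normality proof is irrelevant so that it cannot distinguish equal trees.
record Clopen : Set where
  constructor clopen
  field
    tree : Tree
    .normal : Normal tree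
open Clopen

lift₂ : (Bool → Bool → Bool) → Clopen → Clopen → Clopen
lift₂ f x y = clopen (zipWith f (tree x) (tree y)) (zipWith-normal f (tree x) (tree y))

_∪_ _∩_ : Clopen → Clopen → Clopen
_∪_ = lift₂ _∨_
_∩_ = lift₂ _∧_

empty full : Clopen
empty = clopen (leaf false) tt
full = clopen (leaf true) tt

∁ : Clopen → Clopen
∁ = lift₂ _xor_ full

⟦_⟧ᶜ : Clopen → Path → Bool
⟦ x ⟧ᶜ = ⟦ tree x ⟧

⟦lift₂⟧ : ∀ f x y p → ⟦ lift₂ f x y ⟧ᶜ p ≡ f (⟦ x ⟧ᶜ p) (⟦ y ⟧ᶜ p)
⟦lift₂⟧ f x y = ⟦zipWith⟧ f (tree x) (tree y)

⟦∁⟧ : ∀ x p → ⟦ ∁ x ⟧ᶜ p ≡ not (⟦ x ⟧ᶜ p)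
⟦∁⟧ = ⟦lift₂⟧ _xor_ full

clopen-ext : ∀ {x y} → ⟦ x ⟧ᶜ ≗ ⟦ y ⟧ᶜ → x ≡ y
clopen-ext {clopen s ns} {clopen t nt} eq with ⟦⟧-injective ns nt eq
... | refl = refl

⟦⟧ᶜ-isLatticeMonomorphism : IsLatticeMonomorphism
  (record { _≈_ = _≡_ ; _∧_ = _∩_ ; _∨_ = _∪_ })
  (record { _≈_ = _≗_ ; _∧_ = λ f g p → f p ∧ g p ; _∨_ = λ f g p → f p ∨ g p })
  ⟦_⟧ᶜ
⟦⟧ᶜ-isLatticeMonomorphism = record
  { isLatticeHomomorphism = record
    { isRelHomomorphism = record { cong = λ { refl _ → refl } }
    ; ∧-homo = ⟦lift₂⟧ _∧_
    ; ∨-homo = ⟦lift₂⟧ _∨_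
    }
  ; injective = clopen-ext
  }

clopen-isBooleanAlgebra : IsBooleanAlgebra _≡_ _∪_ _∩_ ∁ full empty
clopen-isBooleanAlgebra = isBooleanAlgebraʳ record
  { isDistributiveLattice = LatticeMonomorphism.isDistributiveLattice ⟦⟧ᶜ-isLatticeMonomorphism
      (pointwise-isDistributiveLattice Bool.∨-∧-isDistributiveLattice)
  ; ∨-complementʳ = λ x → clopen-ext λ p →
      trans (⟦lift₂⟧ _∨_ x (∁ x) p)
            (trans (cong (⟦ x ⟧ᶜ p ∨_) (⟦∁⟧ x p)) (Bool.∨-inverseʳ (⟦ x ⟧ᶜ p)))
  ; ∧-complementʳ = λ x → clopen-ext λ p →
      trans (⟦lift₂⟧ _∧_ x (∁ x) p)
            (trans (cong (⟦ x ⟧ᶜ p ∧_) (⟦∁⟧ x p)) (Bool.∧-inverseʳ (⟦ x ⟧ᶜ p)))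
  ; ¬-cong = cong ∁
  }

cylinder-or-empty : ∀ t → (∃ λ bs → ∀ q → ⟦ t ⟧ (prefix bs q) ≡ true)
                        ⊎ (∀ p → ⟦ t ⟧ p ≡ false)
cylinder-or-empty (leaf true) = inj₁ ([] , λ _ → refl)
cylinder-or-empty (leaf false) = inj₂ λ _ → refl
cylinder-or-empty (node l r) with cylinder-or-empty l | cylinder-or-empty r
... | inj₁ (bs , l-true) | _ = inj₁ (false ∷ bs , l-true)
... | inj₂ _ | inj₁ (bs , r-true) = inj₁ (true ∷ bs , r-true)
... | inj₂ l-false | inj₂ r-false = inj₂ λ p → both-false (p zero)
  where
  both-false : ∀ {p} b → (if b then ⟦ r ⟧ p else ⟦ l ⟧ p) ≡ false
  both-false true = r-false _
  both-false false = l-false _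

bit : ℕ → Tree
bit zero = node (leaf false) (leaf true)
bit (suc n) = branch (bit n) (bit n)

bit-normal : ∀ n → Normal (bit n)
bit-normal zero = tt , tt , λ ()
bit-normal (suc n) = branch-normal (bit-normal n) (bit-normal n)

⟦bit⟧ : ∀ n p → ⟦ bit n ⟧ p ≡ p n
⟦bit⟧ zero p with p zero
... | true = refl
... | false = refl
⟦bit⟧ (suc n) p rewrite ⟦branch⟧ (bit n) (bit n) p with p zero
... | true = ⟦bit⟧ n _
... | false = ⟦bit⟧ n _

prefix-length : ∀ bs b q → prefix bs (b ◂ q) (length bs) ≡ b
prefix-length [] b q = refl
prefix-length (_ ∷ bs) b q = prefix-length bs b q

_≟empty : ∀ x → Dec (x ≡ empty)
x ≟empty with cylinder-or-empty (tree x)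
... | inj₂ x-false = yes (clopen-ext x-false)
... | inj₁ (bs , x-true) = no λ x≡empty →
  case trans (sym (x-true (λ _ → false))) (cong-app (cong ⟦_⟧ᶜ x≡empty) _) of λ ()

-- a contains the cylinder of paths extending bs; c cuts it in half by the next bit.
clopen-splitting : ∀ a → ¬ a ≡ empty → ∃ λ c → ¬ a ∩ c ≡ empty × ¬ a ∩ c ≡ a
clopen-splitting a a≢empty with cylinder-or-empty (tree a)
... | inj₂ a-false = ⊥-elim (a≢empty (clopen-ext a-false))
... | inj₁ (bs , a-true) = c , a∩c≢empty , a∩c≢a
  where
  c : Clopen
  c = clopen (bit (length bs)) (bit-normal (length bs))
  at : Bool → Path
  at b = prefix bs (b ◂ λ _ → false)
  ⟦a∩c⟧ : ∀ b → ⟦ a ∩ c ⟧ᶜ (at b) ≡ b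
  ⟦a∩c⟧ b = begin
    ⟦ a ∩ c ⟧ᶜ (at b)             ≡⟨ ⟦lift₂⟧ _∧_ a c (at b) ⟩
    ⟦ a ⟧ᶜ (at b) ∧ ⟦ c ⟧ᶜ (at b)  ≡⟨ cong₂ _∧_ (a-true _) (⟦bit⟧ (length bs) (at b)) ⟩
    true ∧ at b (length bs)       ≡⟨ prefix-length bs b _ ⟩
    b                             ∎
    where open ≡-Reasoning
  a∩c≢empty : ¬ a ∩ c ≡ empty
  a∩c≢empty e = case trans (sym (⟦a∩c⟧ true)) (cong-app (cong ⟦_⟧ᶜ e) (at true)) of λ ()
  a∩c≢a : ¬ a ∩ c ≡ a
  a∩c≢a e =
    case trans (sym (⟦a∩c⟧ false)) (trans (cong-app (cong ⟦_⟧ᶜ e) (at false)) (a-true _)) of λ ()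

module ClopenContact = FullContact clopen-isBooleanAlgebra _≟empty

clopenContactAlgebra : BCA
clopenContactAlgebra = ClopenContact.fullContactAlgebra

half : Clopen
half = clopen (bit zero) (bit-normal zero)

-- Contact algebras of finite graphs and the path on three points

module GraphContact {n} (_~_ : Rel (Fin n) 0ℓ)
  (~-refl : Reflexive _~_) (~-sym : Symmetric _~_) (_~?_ : Decidable _~_) where

  _touches_ : Subset n → Subset n → Set
  x touches y = ∃₂ λ i j → i ∈ x × j ∈ y × i ~ j

  _touches?_ : ∀ x y → Dec (x touches y)
  x touches? y = any? λ i → any? λ j → (i ∈? x) ×-dec (j ∈? y) ×-dec (i ~? j)

  ∩≡⇒⊆ : ∀ {x y : Subset n} {i} → x S.∩ y ≡ x → i ∈ x → i ∈ y
  ∩≡⇒⊆ {x} {y} x∩y≡x i∈x = proj₂ (x∈p∩q⁻ x y (subst (_ ∈_) (sym x∩y≡x) i∈x))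

  ≢⊥⇒nonempty : ∀ {x : Subset n} → ¬ x ≡ S.⊥ → Nonempty x
  ≢⊥⇒nonempty {x} x≢⊥ with nonempty? x
  ... | yes x-nonempty = x-nonempty
  ... | no x-empty = ⊥-elim (x≢⊥ (Empty-unique x-empty))

  graphContactAlgebra : BCA
  graphContactAlgebra = record
    { B = Subset n ; _·_ = S._∩_ ; _+_ = S._∪_ ; -_ = S.∁ ; 𝟘 = S.⊥ ; 𝟙 = S.⊤
    ; isBooleanAlgebra = ∪-∩-isBooleanAlgebra n
    ; _C_ = _touches_
    ; C0 = λ { _ (_ , _ , i∈⊥ , _) → ∉⊥ i∈⊥ }
    ; C1 = λ _ _ x≤y x≢⊥ → let (i , i∈x) = ≢⊥⇒nonempty x≢⊥ in
                             i , i , i∈x , ∩≡⇒⊆ x≤y i∈x , ~-refl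
    ; C2 = λ { _ _ (i , j , i∈x , j∈y , i~j) → j , i , j∈y , i∈x , ~-sym i~j }
    ; C3 = λ { _ _ x≤y _ (i , j , i∈z , j∈x , i~j) → i , j , i∈z , ∩≡⇒⊆ x≤y j∈x , i~j }
    ; C4 = λ { _ y z (i , j , i∈x , j∈y∪z , i~j) →
               [ (λ j∈y → inj₁ (i , j , i∈x , j∈y , i~j))
               , (λ j∈z → inj₂ (i , j , i∈x , j∈z , i~j)) ]
               (x∈p∪q⁻ y z j∈y∪z) }
    }

_≟ˢ_ : ∀ {n} (x y : Subset n) → Dec (x ≡ y)
_≟ˢ_ = ≡-dec Bool._≟_

∀-Subset? : ∀ {n} {P : Pred (Subset n) 0ℓ} → (∀ x → Dec (P x)) → Dec (∀ x → P x)
∀-Subset? P? with anySubset? (¬? ∘ P?)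
... | yes (x , ¬Px) = no λ ∀P → ¬Px (∀P x)
... | no ∄¬P = yes λ x → decidable-stable (P? x) λ ¬Px → ∄¬P (x , ¬Px)

record Adjacent {n} (i j : Fin n) : Set where
  constructor adjacent
  field
    distance≤1 : ∣ toℕ i - toℕ j ∣ ≤ℕ 1

Adjacent-refl : ∀ {n} → Reflexive (Adjacent {n})
Adjacent-refl {x = i} = adjacent (subst (_≤ℕ 1) (sym (∣n-n∣≡0 (toℕ i))) z≤n)

Adjacent-sym : ∀ {n} → Symmetric (Adjacent {n})
Adjacent-sym {x = i} {j} (adjacent d≤1) = adjacent (subst (_≤ℕ 1) (∣-∣-comm (toℕ i) (toℕ j)) d≤1)

Adjacent? : ∀ {n} → Decidable (Adjacent {n})
Adjacent? i j = Dec.map′ adjacent Adjacent.distance≤1 (∣ toℕ i - toℕ j ∣ ≤? 1)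

module PathContact = GraphContact (Adjacent {3}) Adjacent-refl Adjacent-sym Adjacent?
open PathContact using (_touches_; _touches?_)

pathContactAlgebra : BCA
pathContactAlgebra = PathContact.graphContactAlgebra

open BCA pathContactAlgebra using (_≪_; _·_; -_; 𝟘; 𝟙)

_≪?_ : ∀ x y → Dec (x ≪ y)
x ≪? y = ¬? (x touches? (- y))

p r : Subset 3
p = ⁅ zero ⁆
r = ⁅ suc (suc zero) ⁆

≪p⇒≡𝟘 : ∀ y → y ≪ p → y ≡ 𝟘
≪p⇒≡𝟘 = from-yes (∀-Subset? λ y → (y ≪? p) →-dec (y ≟ˢ 𝟘))

p-isAtom : BCA.IsAtom pathContactAlgebra p
p-isAtom = (λ ()) , from-yes (∀-Subset? λ x → ((x · p) ≟ˢ x) →-dec ((x ≟ˢ 𝟘) ⊎-dec (x ≟ˢ p)))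

≪-chain-reaches-𝟙 : ∀ u v w t → ¬ t ≡ 𝟘 → t ≪ w → w ≪ v → v ≪ u → u ≡ 𝟙
≪-chain-reaches-𝟙 = from-yes (∀-Subset? λ u → ∀-Subset? λ v → ∀-Subset? λ w → ∀-Subset? λ t →
  ¬? (t ≟ˢ 𝟘) →-dec (t ≪? w) →-dec (w ≪? v) →-dec (v ≪? u) →-dec (u ≟ˢ 𝟙))

pathContact-¬C5 : ¬ BCA.C5 pathContactAlgebra
pathContact-¬C5 c5 with c5 p (λ ())
... | y , y≢𝟘 , y≪p = y≢𝟘 (≪p⇒≡𝟘 y y≪p)

p-not-touching-r : ¬ p touches r
p-not-touching-r = from-no (p touches? r)

pathContact-noGRep : ∀ Q → ¬ BCA.IsGRep pathContactAlgebra Q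
pathContact-noGRep Q (_ , r0Q , _ , r2Q , r3Q) =
  p-not-touching-r (⊆⁅𝟙⁆∧r3⇒connected pathContactAlgebra r3Q Q⊆⁅𝟙⁆ (λ ()) (λ ()))
  where
  Q⊆⁅𝟙⁆ : ∀ u → Q u → u ≡ 𝟙
  Q⊆⁅𝟙⁆ u Qu with r2⇒descent pathContactAlgebra r2Q Qu
  ... | v , w , t , Qt , t≪w , w≪v , v≪u =
    ≪-chain-reaches-𝟙 u v w t (λ t≡𝟘 → r0Q (subst Q t≡𝟘 Qt)) t≪w w≪v v≪u

theorem4p5 : (Σ BCA λ 𝔅 → ¬ BCA.C5 𝔅 × ¬ BCA.HasAtoms 𝔅
    × Σ (Pred (BCA.B 𝔅) 0ℓ) λ Q → BCA.IsGRep 𝔅 Q × ¬ BCA.IsWRep 𝔅 Q)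
    × (Σ BCA λ 𝔅 → ¬ BCA.C5 𝔅 × BCA.HasAtoms 𝔅
    × (∀ (Q : Pred (BCA.B 𝔅) 0ℓ) → BCA.IsGRep 𝔅 Q → BCA.IsWRep 𝔅 Q))
theorem4p5 =
    ( clopenContactAlgebra
    , ClopenContact.fullContact-¬C5 half (λ ()) (λ ())
    , splitting⇒¬HasAtoms clopenContactAlgebra clopen-splitting
    , ⁅𝟙⁆ clopenContactAlgebra
    , ⁅𝟙⁆-isGRep clopenContactAlgebra (λ ()) ClopenContact.fullContact-connected
    , ⁅𝟙⁆-¬isWRep clopenContactAlgebra (λ ()) )
  , ( pathContactAlgebra
    , pathContact-¬C5
    , (p , p-isAtom)
    , λ Q Q-isGRep → ⊥-elim (pathContact-noGRep Q Q-isGRep) )
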